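{- Let $\{b_1,\ldots,b_m\}$ be a multiset of positive integers, and let $\{a_1,\ldots,a_m\}$ and $\{a_1',\ldots,a_m'\}$ be multisets of positive integers such that both $\prod_{k=1}^m[a_k]_q/[b_k]_q$ and $\prod_{k=1}^m[a_k']_q/[b_k]_q$ are basic cyclotomic generating functions. Then there exists a multiset $\{h_1,\ldots,h_m\}$ of positive integers such that for all $1\le i\le m$ both \[ \frac{\prod_{k=1}^i[h_k]_q\prod_{k=i+1}^m[a_k]_q}{\prod_{k=1}^m[b_k]_q}\quad\text{and}\quad\frac{\prod_{k=1}^i[h_k]_q\prod_{k=i+1}^m[a_k']_q}{\prod_{k=1}^m[b_k]_q} \] are basic cyclotomic generating functions.
   Context: $[n]_q=1+q+\cdots+q^{n-1}$. A basic cyclotomic generating function is a polynomial with nonnegative integer coefficients of the form $\prod_{j=1}^m[a_j]_q/[b_j]_q$ for multisets of positive integers. -}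

module Defs where

open import Data.Nat using (ℕ; zero; suc; _*_; _+_; _<_)
open import Data.List using (List; []; _∷_; map; replicate; foldr)
open import Data.List.Relation.Unary.All using (All)
open import Data.Product using (Σ)
open import Relation.Binary.PropositionalEquality using (_≡_)

-- Polynomials in q with natural-number coefficients, as coefficient lists
-- (constant term first).
Poly : Set
Poly = List ℕ

coeff : Poly → ℕ → ℕ
coeff []       _       = 0
coeff (c ∷ _)  zero    = c
coeff (_ ∷ p)  (suc n) = coeff p n

-- equality of polynomials (coefficientwise; insensitive to trailing zeros)
_≈ₚ_ : Poly → Poly → Set
p ≈ₚ r = ∀ n → coeff p n ≡ coeff r n

infixl 6 _+ₚ_
infixl 7 _*ₚ_

_+ₚ_ : Poly → Poly → Poly
[]      +ₚ r       = r
(c ∷ p) +ₚ []      = c ∷ p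
(c ∷ p) +ₚ (d ∷ r) = (c + d) ∷ (p +ₚ r)

_*ₚ_ : Poly → Poly → Poly
[]      *ₚ r = []
(c ∷ p) *ₚ r = map (c *_) r +ₚ (0 ∷ (p *ₚ r))

qint : ℕ → Poly
qint n = replicate n 1

prodQ : List ℕ → Poly
prodQ = foldr (λ x acc → qint x *ₚ acc) (1 ∷ [])

-- ∏[a_j]_q / ∏[b_j]_q is a basic cyclotomic generating function:
-- it is a polynomial with nonnegative integer coefficients, i.e. there is
-- P ∈ ℕ[q] with P · ∏[b_j]_q = ∏[a_j]_q.
IsBCGF : List ℕ → List ℕ → Set
IsBCGF as bs = Σ Poly (λ P → (P *ₚ prodQ bs) ≈ₚ prodQ as)

AllPos : List ℕ → Set
AllPos = All (0 <_)

module Submission where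

open import Defs
open import Data.Nat using (ℕ; zero; suc; _+_; _*_; _≤_; s≤s; z≤n)
open import Data.Nat.Properties
  using (+-identityʳ; *-identityˡ; *-zeroʳ; *-comm; *-assoc; *-distribˡ-+; *-distribʳ-+;
         suc-injective; ≤-reflexive; m≤n⇒m⊓n≡m; +-commutativeSemigroup)
open import Algebra.Properties.CommutativeSemigroup +-commutativeSemigroup
  using (x∙yz≈y∙xz; interchange)
open import Data.List using (List; []; _∷_; length; take; drop; _++_; map; replicate; zipWith)
open import Data.List.Properties using (take++drop≡id; length-zipWith; zipWith-comm)
open import Data.List.Relation.Unary.All using ([]; _∷_)
open import Data.Product using (Σ; _×_; _,_)
open import Function using (_∘_)
open import Relation.Binary.Bundles using (Setoid)
open import Relation.Binary.Structures using (IsEquivalence)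
open import Relation.Binary.PropositionalEquality
  using (_≡_; refl; sym; trans; cong; cong₂; subst; module ≡-Reasoning)
import Relation.Binary.Reasoning.Setoid as SetoidReasoning

-- Since [ca]_q = [c]_{q^a} [a]_q, the choice h_k := a_k a′_k makes both [a_k]_q and
-- [a′_k]_q divide [h_k]_q in ℕ[q]. Replacing numerator factors by the corresponding h_k
-- therefore multiplies the generating function by a polynomial with nonnegative
-- coefficients, so it stays a basic cyclotomic generating function.

-- _≈ₚ_ wrapped in a record, so that both polynomials can be inferred from a proof.
infix 4 _≋_
record _≋_ (p r : Poly) : Set where
  constructor mk≋
  field coeff-≡ : p ≈ₚ r
open _≋_

≋-isEquivalence : IsEquivalence _≋_
≋-isEquivalence = record
  { refl  = mk≋ λ _ → refl
  ; sym   = λ (mk≋ e) → mk≋ (sym ∘ e)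
  ; trans = λ (mk≋ e) (mk≋ f) → mk≋ λ n → trans (e n) (f n)
  }

≋-setoid : Setoid _ _
≋-setoid = record { isEquivalence = ≋-isEquivalence }

open IsEquivalence ≋-isEquivalence using ()
  renaming (refl to ≋-refl; sym to ≋-sym; trans to ≋-trans)
module ≋-Reasoning = SetoidReasoning ≋-setoid

coeff-+ₚ : ∀ p r n → coeff (p +ₚ r) n ≡ coeff p n + coeff r n
coeff-+ₚ []      r       n       = refl
coeff-+ₚ (c ∷ p) []      n       = sym (+-identityʳ _)
coeff-+ₚ (c ∷ p) (d ∷ r) zero    = refl
coeff-+ₚ (c ∷ p) (d ∷ r) (suc n) = coeff-+ₚ p r n

coeff-map-* : ∀ c r n → coeff (map (c *_) r) n ≡ c * coeff r n
coeff-map-* c []      n       = sym (*-zeroʳ c)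
coeff-map-* c (d ∷ r) zero    = refl
coeff-map-* c (d ∷ r) (suc n) = coeff-map-* c r n

coeff-∷-*ₚ : ∀ c p r n → coeff ((c ∷ p) *ₚ r) n ≡ c * coeff r n + coeff (0 ∷ (p *ₚ r)) n
coeff-∷-*ₚ c p r n =
  trans (coeff-+ₚ (map (c *_) r) (0 ∷ (p *ₚ r)) n) (cong (_+ _) (coeff-map-* c r n))

∷-cong : ∀ {c d p r} → c ≡ d → p ≋ r → c ∷ p ≋ d ∷ r
∷-cong c≡d (mk≋ e) = mk≋ λ where
  zero    → c≡d
  (suc n) → e n

0∷-zero : ∀ {p} → p ≋ [] → 0 ∷ p ≋ []
0∷-zero (mk≋ e) = mk≋ λ where
  zero    → refl
  (suc n) → e n

+ₚ-cong : ∀ {p p′ r r′} → p ≋ p′ → r ≋ r′ → p +ₚ r ≋ p′ +ₚ r′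
+ₚ-cong {p} {p′} {r} {r′} (mk≋ e) (mk≋ f) = mk≋ λ n → begin
  coeff (p +ₚ r) n         ≡⟨ coeff-+ₚ p r n ⟩
  coeff p n + coeff r n    ≡⟨ cong₂ _+_ (e n) (f n) ⟩
  coeff p′ n + coeff r′ n  ≡⟨ sym (coeff-+ₚ p′ r′ n) ⟩
  coeff (p′ +ₚ r′) n       ∎
  where open ≡-Reasoning

+ₚ-identityʳ : ∀ p → p +ₚ [] ≋ p
+ₚ-identityʳ p = mk≋ λ n → trans (coeff-+ₚ p [] n) (+-identityʳ _)

+ₚ-leftComm : ∀ p r s → p +ₚ (r +ₚ s) ≋ r +ₚ (p +ₚ s)
+ₚ-leftComm p r s = mk≋ λ n → begin
  coeff (p +ₚ (r +ₚ s)) n                ≡⟨ coeff-+ₚ p (r +ₚ s) n ⟩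
  coeff p n + coeff (r +ₚ s) n           ≡⟨ cong (coeff p n +_) (coeff-+ₚ r s n) ⟩
  coeff p n + (coeff r n + coeff s n)    ≡⟨ x∙yz≈y∙xz (coeff p n) (coeff r n) (coeff s n) ⟩
  coeff r n + (coeff p n + coeff s n)    ≡⟨ cong (coeff r n +_) (coeff-+ₚ p s n) ⟨
  coeff r n + coeff (p +ₚ s) n           ≡⟨ coeff-+ₚ r (p +ₚ s) n ⟨
  coeff (r +ₚ (p +ₚ s)) n                ∎
  where open ≡-Reasoning

map-*-cong : ∀ c {r r′} → r ≋ r′ → map (c *_) r ≋ map (c *_) r′
map-*-cong c {r} {r′} (mk≋ e) = mk≋ λ n → begin
  coeff (map (c *_) r) n   ≡⟨ coeff-map-* c r n ⟩
  c * coeff r n            ≡⟨ cong (c *_) (e n) ⟩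
  c * coeff r′ n           ≡⟨ coeff-map-* c r′ n ⟨
  coeff (map (c *_) r′) n  ∎
  where open ≡-Reasoning

*ₚ-congˡ : ∀ p {r r′} → r ≋ r′ → p *ₚ r ≋ p *ₚ r′
*ₚ-congˡ []      e = ≋-refl
*ₚ-congˡ (c ∷ p) e = +ₚ-cong (map-*-cong c e) (∷-cong refl (*ₚ-congˡ p e))

*ₚ-zeroʳ : ∀ p → p *ₚ [] ≋ []
*ₚ-zeroʳ []      = ≋-refl
*ₚ-zeroʳ (c ∷ p) = 0∷-zero (*ₚ-zeroʳ p)

*ₚ-identityˡ : ∀ r → (1 ∷ []) *ₚ r ≋ r
*ₚ-identityˡ r = mk≋ λ n → begin
  coeff ((1 ∷ []) *ₚ r) n           ≡⟨ coeff-∷-*ₚ 1 [] r n ⟩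
  1 * coeff r n + coeff (0 ∷ []) n  ≡⟨ cong₂ _+_ (*-identityˡ _) (coeff-0∷[] n) ⟩
  coeff r n + 0                     ≡⟨ +-identityʳ _ ⟩
  coeff r n                         ∎
  where
  open ≡-Reasoning
  coeff-0∷[] : ∀ n → coeff (0 ∷ []) n ≡ 0
  coeff-0∷[] zero    = refl
  coeff-0∷[] (suc n) = refl

0∷-*ₚ : ∀ p r → (0 ∷ p) *ₚ r ≋ 0 ∷ (p *ₚ r)
0∷-*ₚ p r = mk≋ (coeff-∷-*ₚ 0 p r)

map-*-*ₚ : ∀ c r s → map (c *_) r *ₚ s ≋ map (c *_) (r *ₚ s)
map-*-*ₚ c []      s = ≋-refl
map-*-*ₚ c (d ∷ r) s = mk≋ coeffs
  where
  open ≡-Reasoning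
  coeffs : (map (c *_) (d ∷ r) *ₚ s) ≈ₚ map (c *_) ((d ∷ r) *ₚ s)
  coeffs n = begin
    coeff ((c * d ∷ map (c *_) r) *ₚ s) n  ≡⟨ coeff-∷-*ₚ (c * d) (map (c *_) r) s n ⟩
    c * d * sₙ + coeff (0 ∷ cr*s) n        ≡⟨ cong₂ _+_ (*-assoc c d sₙ) tail ⟩
    c * (d * sₙ) + c * rsₙ                 ≡⟨ *-distribˡ-+ c (d * sₙ) rsₙ ⟨
    c * (d * sₙ + rsₙ)                     ≡⟨ cong (c *_) (coeff-∷-*ₚ d r s n) ⟨
    c * coeff ((d ∷ r) *ₚ s) n             ≡⟨ coeff-map-* c ((d ∷ r) *ₚ s) n ⟨
    coeff (map (c *_) ((d ∷ r) *ₚ s)) n    ∎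
    where
    cr*s : Poly
    cr*s = map (c *_) r *ₚ s
    sₙ rsₙ : ℕ
    sₙ   = coeff s n
    rsₙ  = coeff (0 ∷ (r *ₚ s)) n
    tail : coeff (0 ∷ cr*s) n ≡ c * rsₙ
    tail = trans (coeff-≡ (∷-cong (sym (*-zeroʳ c)) (map-*-*ₚ c r s)) n)
                 (coeff-map-* c (0 ∷ (r *ₚ s)) n)

*ₚ-distribʳ-+ₚ : ∀ p r s → (p +ₚ r) *ₚ s ≋ p *ₚ s +ₚ r *ₚ s
*ₚ-distribʳ-+ₚ []      r       s = ≋-refl
*ₚ-distribʳ-+ₚ (c ∷ p) []      s = ≋-sym (+ₚ-identityʳ ((c ∷ p) *ₚ s))
*ₚ-distribʳ-+ₚ (c ∷ p) (d ∷ r) s = mk≋ coeffs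
  where
  open ≡-Reasoning
  coeffs : (((c ∷ p) +ₚ (d ∷ r)) *ₚ s) ≈ₚ ((c ∷ p) *ₚ s +ₚ (d ∷ r) *ₚ s)
  coeffs n = begin
    coeff ((c + d ∷ p +ₚ r) *ₚ s) n
      ≡⟨ coeff-∷-*ₚ (c + d) (p +ₚ r) s n ⟩
    (c + d) * sₙ + coeff (0 ∷ ((p +ₚ r) *ₚ s)) n
      ≡⟨ cong₂ _+_ (*-distribʳ-+ sₙ c d) tail ⟩
    (c * sₙ + d * sₙ) + (psₙ + rsₙ)
      ≡⟨ interchange (c * sₙ) (d * sₙ) psₙ rsₙ ⟩
    (c * sₙ + psₙ) + (d * sₙ + rsₙ)
      ≡⟨ cong₂ _+_ (coeff-∷-*ₚ c p s n) (coeff-∷-*ₚ d r s n) ⟨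
    coeff ((c ∷ p) *ₚ s) n + coeff ((d ∷ r) *ₚ s) n
      ≡⟨ coeff-+ₚ ((c ∷ p) *ₚ s) ((d ∷ r) *ₚ s) n ⟨
    coeff ((c ∷ p) *ₚ s +ₚ (d ∷ r) *ₚ s) n
      ∎
    where
    sₙ psₙ rsₙ : ℕ
    sₙ  = coeff s n
    psₙ = coeff (0 ∷ (p *ₚ s)) n
    rsₙ = coeff (0 ∷ (r *ₚ s)) n
    tail : coeff (0 ∷ ((p +ₚ r) *ₚ s)) n ≡ psₙ + rsₙ
    tail = trans (coeff-≡ (∷-cong refl (*ₚ-distribʳ-+ₚ p r s)) n)
                 (coeff-+ₚ (0 ∷ (p *ₚ s)) (0 ∷ (r *ₚ s)) n)

*ₚ-assoc : ∀ p r s → (p *ₚ r) *ₚ s ≋ p *ₚ (r *ₚ s)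
*ₚ-assoc []      r s = ≋-refl
*ₚ-assoc (c ∷ p) r s = begin
  (map (c *_) r +ₚ (0 ∷ (p *ₚ r))) *ₚ s
    ≈⟨ *ₚ-distribʳ-+ₚ (map (c *_) r) (0 ∷ (p *ₚ r)) s ⟩
  map (c *_) r *ₚ s +ₚ (0 ∷ (p *ₚ r)) *ₚ s
    ≈⟨ +ₚ-cong (map-*-*ₚ c r s) (0∷-*ₚ (p *ₚ r) s) ⟩
  map (c *_) (r *ₚ s) +ₚ (0 ∷ ((p *ₚ r) *ₚ s))
    ≈⟨ +ₚ-cong ≋-refl (∷-cong refl (*ₚ-assoc p r s)) ⟩
  map (c *_) (r *ₚ s) +ₚ (0 ∷ (p *ₚ (r *ₚ s)))
    ∎
  where open ≋-Reasoning

*ₚ-∷ : ∀ p c r → p *ₚ (c ∷ r) ≋ map (c *_) p +ₚ (0 ∷ (p *ₚ r))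
*ₚ-∷ []      c r = ≋-sym (0∷-zero ≋-refl)
*ₚ-∷ (d ∷ p) c r = ∷-cong (cong (_+ 0) (*-comm d c)) (begin
  map (d *_) r +ₚ p *ₚ (c ∷ r)
    ≈⟨ +ₚ-cong ≋-refl (*ₚ-∷ p c r) ⟩
  map (d *_) r +ₚ (map (c *_) p +ₚ (0 ∷ (p *ₚ r)))
    ≈⟨ +ₚ-leftComm (map (d *_) r) (map (c *_) p) (0 ∷ (p *ₚ r)) ⟩
  map (c *_) p +ₚ (map (d *_) r +ₚ (0 ∷ (p *ₚ r)))
    ∎)
  where open ≋-Reasoning

*ₚ-comm : ∀ p r → p *ₚ r ≋ r *ₚ p
*ₚ-comm []      r = ≋-sym (*ₚ-zeroʳ r)
*ₚ-comm (c ∷ p) r = ≋-trans (+ₚ-cong ≋-refl (∷-cong refl (*ₚ-comm p r))) (≋-sym (*ₚ-∷ r c p))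

*ₚ-congʳ : ∀ {p p′} r → p ≋ p′ → p *ₚ r ≋ p′ *ₚ r
*ₚ-congʳ {p} {p′} r e = ≋-trans (*ₚ-comm p r) (≋-trans (*ₚ-congˡ r e) (*ₚ-comm r p′))

shift : ℕ → Poly → Poly
shift k p = replicate k 0 ++ p

shift-cong : ∀ k {p r} → p ≋ r → shift k p ≋ shift k r
shift-cong zero    e = e
shift-cong (suc k) e = ∷-cong refl (shift-cong k e)

shift-*ₚ : ∀ k p r → shift k p *ₚ r ≋ shift k (p *ₚ r)
shift-*ₚ zero    p r = ≋-refl
shift-*ₚ (suc k) p r = ≋-trans (0∷-*ₚ (shift k p) r) (∷-cong refl (shift-*ₚ k p r))

qint-+ : ∀ m n → qint (m + n) ≋ qint m +ₚ shift m (qint n)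
qint-+ zero    n = ≋-refl
qint-+ (suc m) n = ∷-cong refl (qint-+ m n)

qintAtPower : ℕ → ℕ → Poly
qintAtPower a zero    = []
qintAtPower a (suc c) = (1 ∷ []) +ₚ shift a (qintAtPower a c)

qintAtPower-*ₚ-qint : ∀ a c → qintAtPower a c *ₚ qint a ≋ qint (c * a)
qintAtPower-*ₚ-qint a zero    = ≋-refl
qintAtPower-*ₚ-qint a (suc c) = begin
  ((1 ∷ []) +ₚ shift a (qintAtPower a c)) *ₚ qint a
    ≈⟨ *ₚ-distribʳ-+ₚ (1 ∷ []) (shift a (qintAtPower a c)) (qint a) ⟩
  (1 ∷ []) *ₚ qint a +ₚ shift a (qintAtPower a c) *ₚ qint a
    ≈⟨ +ₚ-cong (*ₚ-identityˡ (qint a)) (shift-*ₚ a (qintAtPower a c) (qint a)) ⟩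
  qint a +ₚ shift a (qintAtPower a c *ₚ qint a)
    ≈⟨ +ₚ-cong ≋-refl (shift-cong a (qintAtPower-*ₚ-qint a c)) ⟩
  qint a +ₚ shift a (qint (c * a))
    ≈⟨ qint-+ a (c * a) ⟨
  qint (a + c * a)
    ∎
  where open ≋-Reasoning

infix 4 _∣ₚ_
_∣ₚ_ : Poly → Poly → Set
p ∣ₚ r = Σ Poly λ quotient → quotient *ₚ p ≋ r

∣ₚ-refl : ∀ {p} → p ∣ₚ p
∣ₚ-refl {p} = 1 ∷ [] , *ₚ-identityˡ p

∣ₚ-trans : ∀ {p r s} → p ∣ₚ r → r ∣ₚ s → p ∣ₚ s
∣ₚ-trans {p} (x , xp≋r) (y , yr≋s) =
  y *ₚ x , ≋-trans (*ₚ-assoc y x p) (≋-trans (*ₚ-congˡ y xp≋r) yr≋s)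

∣ₚ-respˡ : ∀ {p p′ r} → p ≋ p′ → p ∣ₚ r → p′ ∣ₚ r
∣ₚ-respˡ p≋p′ (x , xp≋r) = x , ≋-trans (*ₚ-congˡ x (≋-sym p≋p′)) xp≋r

∣ₚ-respʳ : ∀ {p r r′} → r ≋ r′ → p ∣ₚ r → p ∣ₚ r′
∣ₚ-respʳ r≋r′ (x , xp≋r) = x , ≋-trans xp≋r r≋r′

*ₚ-pres-∣ₚ : ∀ {p p′ r r′} → p ∣ₚ r → p′ ∣ₚ r′ → p *ₚ p′ ∣ₚ r *ₚ r′
*ₚ-pres-∣ₚ {p} {p′} {r} {r′} (x , xp≋r) (y , yp′≋r′) = x *ₚ y , (begin
  (x *ₚ y) *ₚ (p *ₚ p′)   ≈⟨ *ₚ-assoc x y (p *ₚ p′) ⟩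
  x *ₚ (y *ₚ (p *ₚ p′))   ≈⟨ *ₚ-congˡ x (*ₚ-assoc y p p′) ⟨
  x *ₚ ((y *ₚ p) *ₚ p′)   ≈⟨ *ₚ-congˡ x (*ₚ-congʳ p′ (*ₚ-comm y p)) ⟩
  x *ₚ ((p *ₚ y) *ₚ p′)   ≈⟨ *ₚ-congˡ x (*ₚ-assoc p y p′) ⟩
  x *ₚ (p *ₚ (y *ₚ p′))   ≈⟨ *ₚ-assoc x p (y *ₚ p′) ⟨
  (x *ₚ p) *ₚ (y *ₚ p′)   ≈⟨ *ₚ-congʳ (y *ₚ p′) xp≋r ⟩
  r *ₚ (y *ₚ p′)          ≈⟨ *ₚ-congˡ r yp′≋r′ ⟩
  r *ₚ r′                 ∎)
  where open ≋-Reasoning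

qint-∣ₚ-qint-* : ∀ m n → qint n ∣ₚ qint (m * n)
qint-∣ₚ-qint-* m n = qintAtPower n m , qintAtPower-*ₚ-qint n m

prodQ-++ : ∀ xs ys → prodQ (xs ++ ys) ≋ prodQ xs *ₚ prodQ ys
prodQ-++ []       ys = ≋-sym (*ₚ-identityˡ (prodQ ys))
prodQ-++ (x ∷ xs) ys =
  ≋-trans (*ₚ-congˡ (qint x) (prodQ-++ xs ys))
          (≋-sym (*ₚ-assoc (qint x) (prodQ xs) (prodQ ys)))

IsBCGF⇒∣ₚ : ∀ {as bs} → IsBCGF as bs → prodQ bs ∣ₚ prodQ as
IsBCGF⇒∣ₚ (P , e) = P , mk≋ e

∣ₚ⇒IsBCGF : ∀ {as bs} → prodQ bs ∣ₚ prodQ as → IsBCGF as bs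
∣ₚ⇒IsBCGF (P , mk≋ e) = P , e

IsBCGF-replace-++ : ∀ xs ys t bs →
  prodQ xs ∣ₚ prodQ t → IsBCGF (xs ++ ys) bs → IsBCGF (t ++ ys) bs
IsBCGF-replace-++ xs ys t bs xs∣t bcgf =
  ∣ₚ⇒IsBCGF {t ++ ys} {bs} (∣ₚ-trans (IsBCGF⇒∣ₚ {xs ++ ys} {bs} bcgf) xs++ys∣t++ys)
  where
  xs++ys∣t++ys : prodQ (xs ++ ys) ∣ₚ prodQ (t ++ ys)
  xs++ys∣t++ys = ∣ₚ-respˡ (≋-sym (prodQ-++ xs ys)) (∣ₚ-respʳ (≋-sym (prodQ-++ t ys))
    (*ₚ-pres-∣ₚ xs∣t (∣ₚ-refl {prodQ ys})))

IsBCGF-replace-take : ∀ i xs t bs →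
  prodQ (take i xs) ∣ₚ prodQ t → IsBCGF xs bs → IsBCGF (t ++ drop i xs) bs
IsBCGF-replace-take i xs t bs take∣t bcgf =
  IsBCGF-replace-++ (take i xs) (drop i xs) t bs take∣t
    (subst (λ zs → IsBCGF zs bs) (sym (take++drop≡id i xs)) bcgf)

prodQ-take-∣ₚ-zipWith-* : ∀ i xs ys → length xs ≡ length ys →
  prodQ (take i ys) ∣ₚ prodQ (take i (zipWith _*_ xs ys))
prodQ-take-∣ₚ-zipWith-* zero    xs       ys       _   = ∣ₚ-refl
prodQ-take-∣ₚ-zipWith-* (suc i) []       []       _   = ∣ₚ-refl
prodQ-take-∣ₚ-zipWith-* (suc i) (x ∷ xs) (y ∷ ys) len =
  *ₚ-pres-∣ₚ (qint-∣ₚ-qint-* x y) (prodQ-take-∣ₚ-zipWith-* i xs ys (suc-injective len))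

zipWith-*-pos : ∀ {xs ys} → AllPos xs → AllPos ys → AllPos (zipWith _*_ xs ys)
zipWith-*-pos []      _  = []
zipWith-*-pos (_ ∷ _) [] = []
zipWith-*-pos {suc _ ∷ _} {suc _ ∷ _} (s≤s z≤n ∷ xs>0) (s≤s z≤n ∷ ys>0) =
  s≤s z≤n ∷ zipWith-*-pos xs>0 ys>0

lemma3p14 : (m : ℕ) (b a a′ : List ℕ) →
    length b ≡ m → length a ≡ m → length a′ ≡ m →
    AllPos b → AllPos a → AllPos a′ →
    IsBCGF a b → IsBCGF a′ b →
    Σ (List ℕ) (λ h → length h ≡ m × AllPos h ×
      ((i : ℕ) → 1 ≤ i → i ≤ m →
        IsBCGF (take i h ++ drop i a) b × IsBCGF (take i h ++ drop i a′) b))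
-- The replacement works for every i, and nothing about b is needed.
lemma3p14 m b a a′ _ la la′ _ a>0 a′>0 bcgf bcgf′ =
  h , length-h , zipWith-*-pos a′>0 a>0 , λ i _ _ →
    IsBCGF-replace-take i a (take i h) b (prodQ-take-∣ₚ-zipWith-* i a′ a (sym len)) bcgf ,
    IsBCGF-replace-take i a′ (take i h) b
      (subst (λ zs → prodQ (take i a′) ∣ₚ prodQ (take i zs)) (zipWith-comm _*_ *-comm a a′)
        (prodQ-take-∣ₚ-zipWith-* i a a′ len))
      bcgf′
  where
  len : length a ≡ length a′
  len = trans la (sym la′)
  h : List ℕ
  h = zipWith _*_ a′ a
  length-h : length h ≡ m
  length-h =
    trans (length-zipWith _*_ a′ a) (trans (m≤n⇒m⊓n≡m (≤-reflexive (sym len))) la′)
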